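{- Let $\sigma$ be a $C_r\wr S_n$-ordered set partition. Then $\mathrm{maj}$ achieves a unique minimum on $C\wr S(\sigma)$, and this minimum is achieved at $\pi(\sigma)$.
   Context: $\mathcal{A}_{n,r}=\{i^j:1\le i\le n,0\le j\le r-1\}$ ($i^j$ is letter $i$ with color $j$), totally ordered by $1^{r-1}\prec\cdots\prec n^{r-1}\prec1^{r-2}\prec\cdots\prec n^{r-2}\prec\cdots\prec1^0\prec\cdots\prec n^0$. $C_r\wr S_n$ is the set of words $\pi_1\cdots\pi_n$ in $\mathcal{A}_{n,r}$ containing exactly one copy (of some color) of each $i\in[n]$; with color sequence $(\epsilon_1,\dots,\epsilon_n)$, $\mathrm{maj}(\pi)=r\sum_{p:\pi_{p+1}\prec\pi_p}p+\sum_p\epsilon_p$. A $C_r\wr S_n$-ordered set partition is a sequence $\sigma=(B_1|\dots|B_k)$ of nonempty subsets of $\mathcal{A}_{n,r}$ such that for each $i\in[n]$ exactly one copy of $i$ (of one color) appears among the blocks. $C\wr S(\sigma)$ is the set of elements of $C_r\wr S_n$ obtained by writing the blocks in order with letters within each block in any order. $\pi(\sigma)=\pi[1]\cdots\pi[k]$ is defined as follows, all comparisons with respect to $\prec$: write $B_s=\{j^{(s)}_1\prec\cdots\prec j^{(s)}_{\alpha_s}\}$; $\pi[k]=j^{(k)}_1\cdots j^{(k)}_{\alpha_k}$; for $s=k-1,\dots,1$, with $\rho$ the first letter of $\pi[s+1]$ and $0\le m\le\alpha_s$ maximal such that $j^{(s)}_m\preceq\rho$ (with $j^{(s)}_0$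 smaller than everything), set $\pi[s]=j^{(s)}_{m+1}\cdots j^{(s)}_{\alpha_s}j^{(s)}_1\cdots j^{(s)}_m$. -}

module Defs where

open import Data.Nat using (ℕ; zero; suc; _+_; _*_; _<ᵇ_; _≡ᵇ_)
open import Data.Bool using (Bool; true; false; _∨_; _∧_; if_then_else_; not)
open import Data.Fin using (Fin; toℕ)
import Data.Fin as Fin
open import Data.Product using (_×_; _,_; Σ; proj₁; proj₂)
open import Data.Product.Properties using (≡-dec)
open import Data.List using (List; []; _∷_; _++_; concat; length; filter; takeWhile; dropWhile; map)
open import Data.Nat.ListAction using (sum)
open import Data.List.Relation.Binary.Permutation.Propositional using (_↭_)
open import Data.List.Relation.Binary.Pointwise using (Pointwise)
open import Data.List.Relation.Unary.All using (All)
open import Data.Maybe using (Maybe; just; nothing)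
open import Relation.Nullary using (¬_; does)
open import Relation.Binary.PropositionalEquality using (_≡_)

-- The alphabet A_{n,r}: a letter i^j is a pair (i , j), i ∈ Fin n (letter i+1), j ∈ Fin r (color j).
Letter : ℕ → ℕ → Set
Letter n r = Fin n × Fin r

module _ {n r : ℕ} where

  _≺ᵇ_ : Letter n r → Letter n r → Bool
  (i , j) ≺ᵇ (i' , j') = (toℕ j' <ᵇ toℕ j) ∨ ((toℕ j ≡ᵇ toℕ j') ∧ (toℕ i <ᵇ toℕ i'))

  _≟L_ : (x y : Letter n r) → Relation.Nullary.Dec (x ≡ y)
  _≟L_ = ≡-dec Fin._≟_ Fin._≟_

  _⪯ᵇ_ : Letter n r → Letter n r → Bool
  x ⪯ᵇ y = (x ≺ᵇ y) ∨ does (x ≟L y)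

  insert : Letter n r → List (Letter n r) → List (Letter n r)
  insert x [] = x ∷ []
  insert x (y ∷ ys) = if y ≺ᵇ x then y ∷ insert x ys else x ∷ y ∷ ys

  sortL : List (Letter n r) → List (Letter n r)
  sortL [] = []
  sortL (x ∷ xs) = insert x (sortL xs)

  -- descent part of maj: sum of positions p (1-indexed, starting at k) with π_{p+1} ≺ π_p
  desSum : ℕ → List (Letter n r) → ℕ
  desSum k [] = 0
  desSum k (x ∷ []) = 0
  desSum k (x ∷ y ∷ ys) = (if y ≺ᵇ x then k else 0) + desSum (suc k) (y ∷ ys)

  maj : List (Letter n r) → ℕ
  maj w = r * desSum 1 w + sum (map (λ x → toℕ (proj₂ x)) w)

  -- Validity: every block nonempty, and for each i ∈ [n] exactly one copy (of one color)
  -- of i occurs among all blocks (so in particular blocks are duplicate-free and disjoint).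
  IsOSP : List (List (Letter n r)) → Set
  IsOSP σ = All (λ B → ¬ (B ≡ [])) σ
          × ((i : Fin n) → length (filter (λ x → proj₁ x Fin.≟ i) (concat σ)) ≡ 1)

  _∈CwS_ : List (Letter n r) → List (List (Letter n r)) → Set
  w ∈CwS σ = Σ (List (List (Letter n r))) λ ws → Pointwise _↭_ ws σ × w ≡ concat ws

  firstLetter : List (List (Letter n r)) → Maybe (Letter n r)
  firstLetter [] = nothing
  firstLetter ([] ∷ _) = nothing
  firstLetter ((x ∷ _) ∷ _) = just x

  rotateBy : Letter n r → List (Letter n r) → List (Letter n r)
  rotateBy ρ sB = dropWhile (λ x → x ⪯? ρ) sB ++ takeWhile (λ x → x ⪯? ρ) sB
    where
    _⪯?_ : (x y : Letter n r) → Relation.Nullary.Dec (x ⪯ᵇ y ≡ true)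
    x ⪯? y = Data.Bool._≟_ (x ⪯ᵇ y) true
      where import Data.Bool

  piBlocks : List (List (Letter n r)) → List (List (Letter n r))
  piBlocks [] = []
  piBlocks (B ∷ rest) with piBlocks rest
  ... | ps with firstLetter ps
  ...   | nothing = sortL B ∷ ps
  ...   | just ρ = rotateBy ρ (sortL B) ∷ ps

  piσ : List (List (Letter n r)) → List (Letter n r)
  piσ σ = concat (piBlocks σ)

-- The descents of w charged to a block u (those inside
-- u and the one from its last letter to the first letter y of the next block) sit at positions
-- k, k+1, …, where u starts at k; if g letters of u lie above y, all of them precede the last of
-- these descents, so u contributes at least k + g - 1 to the descent sum (0 if g = 0). Only one
-- arrangement of u attains this: the letters above y increasing, then the others increasing,
-- which is the block π[s] of π(σ). Comparing w with π(σ) from the last block backwards, the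
-- suffix of π(σ) starting at position k either beats that of w by at least k, which exceeds the
-- whole cost of the block of π(σ) before it, or beats it while the suffix of w does not start
-- with a larger letter, so that the block of w before it costs at least as much as that of π(σ);
-- either way the comparison extends by one block. The colour part of maj is the same on all of
-- C≀S(σ).

module Submission where

open import Defs
open import Data.Nat using (ℕ; _<_)
open import Data.List using (List)
open import Data.Product using (_×_)
open import Relation.Nullary using (¬_)
open import Relation.Binary.PropositionalEquality using (_≡_)

open import Data.Bool using (true; false; if_then_else_)
import Data.Bool as Bool
open import Data.Bool.Properties using (T-≡; T-∨; T-∧; ¬-not; ∨-identityʳ)
open import Data.Empty using (⊥-elim)
open import Data.Fin using (Fin; toℕ)
import Data.Fin as Fin
open import Data.Fin.Properties using (toℕ-injective; nonZeroIndex)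
open import Data.List using ([]; _∷_; _++_; [_]; concat; length; filter; takeWhile; dropWhile; map)
open import Data.List.Membership.Propositional using (_∈_)
open import Data.List.Membership.Propositional.Properties using (∈-length; ∈-filter⁺)
open import Data.List.Properties
  using (takeWhile++dropWhile; filter-accept; ++-identityʳ; ∷-injectiveˡ; ∷-injectiveʳ; ≡-dec)
open import Data.List.Relation.Binary.Permutation.Propositional
  using (_↭_; ↭-refl; ↭-sym; ↭-trans; ↭-reflexive; prep; swap; ↭⇒↭ₛ)
open import Data.List.Relation.Binary.Permutation.Propositional.Properties
  using (All-resp-↭; ∈-resp-↭; ↭-length; ↭-empty-inv; ¬x∷xs↭[]; drop-∷; ++-comm; ++⁺)
import Data.List.Relation.Binary.Permutation.Propositional.Properties as Perm
import Data.List.Relation.Binary.Permutation.Setoid.Properties as Permₛ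
open import Data.List.Relation.Binary.Pointwise using (Pointwise; []; _∷_)
open import Data.List.Relation.Unary.All as All using (All; []; _∷_)
import Data.List.Relation.Unary.All.Properties as All
open import Data.List.Relation.Unary.AllPairs as AllPairs using (AllPairs; []; _∷_)
import Data.List.Relation.Unary.AllPairs.Properties as AllPairs
open import Data.List.Relation.Unary.Any using (here; there)
open import Data.List.Relation.Unary.Unique.Propositional using (Unique)
open import Data.Maybe using (just; nothing)
open import Data.Nat using (zero; suc; _+_; _*_; _≤_; z≤n; s≤s; _<ᵇ_)
open import Data.Nat.ListAction using (sum)
open import Data.Nat.ListAction.Properties using (sum-↭)
open import Data.Nat.Properties
open import Data.Product using (Σ; _,_; proj₁; proj₂)
import Data.Product as Product
open import Data.Sum using (_⊎_; inj₁; inj₂)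
import Data.Sum as Sum
open import Data.Unit using (⊤)
open import Function using (_∘_; id)
open import Function.Bundles using (Equivalence)
open import Relation.Binary.Definitions using (Transitive; Asymmetric; tri<; tri≈; tri>)
open import Relation.Binary.PropositionalEquality
  using (_≢_; refl; sym; trans; cong; cong₂; subst; subst₂; setoid; module ≡-Reasoning)
open import Relation.Nullary using (yes; no)
open import Relation.Unary using (Decidable)

true≢false : true ≢ false
true≢false ()

Unique-resp-↭ : ∀ {A : Set} {xs ys : List A} → xs ↭ ys → Unique xs → Unique ys
Unique-resp-↭ {A} p = Permₛ.Unique-resp-↭ (setoid A) (↭⇒↭ₛ p)

module _ {A : Set} {R : A → A → Set} where

  AllPairs-++⁻ : ∀ xs {ys} → AllPairs R (xs ++ ys) →
                 AllPairs R xs × AllPairs R ys × All (λ x → All (R x) ys) xs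
  AllPairs-++⁻ [] rs = [] , rs , []
  AllPairs-++⁻ (x ∷ xs) (r ∷ rs) with AllPairs-++⁻ xs rs
  ... | rxs , rys , rxys = All.++⁻ˡ xs r ∷ rxs , rys , All.++⁻ʳ xs r ∷ rxys

  AllPairs-∷-trans : Transitive R → ∀ {x y l} → R x y → AllPairs R (y ∷ l) → AllPairs R (x ∷ y ∷ l)
  AllPairs-∷-trans trans rxy ys@(ry ∷ _) = (rxy ∷ All.map (trans rxy) ry) ∷ ys

  AllPairs-↭⇒≡ : Asymmetric R → ∀ {xs ys} → AllPairs R xs → AllPairs R ys → xs ↭ ys → xs ≡ ys
  AllPairs-↭⇒≡ asym {[]} _ _ p = sym (↭-empty-inv (↭-sym p))
  AllPairs-↭⇒≡ asym {x ∷ xs} {[]} _ _ p = ↭-empty-inv p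
  AllPairs-↭⇒≡ asym {x ∷ xs} {y ∷ ys} (rx ∷ rxs) (ry ∷ rys) p with heads-≡
    where
    heads-≡ : x ≡ y
    heads-≡ with ∈-resp-↭ p (here refl) | ∈-resp-↭ (↭-sym p) (here refl)
    ... | here x≡y | _ = x≡y
    ... | there x∈ys | here y≡x = sym y≡x
    ... | there x∈ys | there y∈xs = ⊥-elim (asym (All.lookup ry x∈ys) (All.lookup rx y∈xs))
  ... | refl = cong (x ∷_) (AllPairs-↭⇒≡ asym rxs rys (drop-∷ p))

-- A block occupying positions k, k+1, … and containing exactly g letters above the
-- letter that follows it has its last descent at a position ≥ k + g - 1 (when g > 0).
optCost : ℕ → ℕ → ℕ
optCost k zero = 0
optCost k (suc g) = k + g

optCost-suc : ∀ k g → optCost (suc k) (suc g) ≡ k + suc g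
optCost-suc k g = sym (+-suc k g)

optCost-monoʳ : ∀ k {g g'} → g ≤ g' → optCost k g ≤ optCost k g'
optCost-monoʳ k z≤n = z≤n
optCost-monoʳ k (s≤s g≤g') = +-monoʳ-≤ k g≤g'

optCost-monoˡ : ∀ k g → optCost k g ≤ optCost (suc k) g
optCost-monoˡ k zero = z≤n
optCost-monoˡ k (suc g) = n≤1+n (k + g)

optCost-<-suc : ∀ k g → optCost k (suc g) < optCost (suc k) (suc g)
optCost-<-suc k g = ≤-refl

g≤optCost : ∀ k g → g ≤ optCost (suc k) g
g≤optCost k zero = z≤n
g≤optCost k (suc g) = s≤s (m≤n+m g k)

optCost<k+ : ∀ {k} → 1 ≤ k → ∀ {g ℓ} → g ≤ ℓ → optCost k g < k + ℓ
optCost<k+ {k} 1≤k {zero} {ℓ} _ = ≤-trans 1≤k (m≤m+n k ℓ)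
optCost<k+ {k} _ {suc g} {ℓ} g<ℓ = subst (_≤ k + ℓ) (+-suc k g) (+-monoʳ-≤ k g<ℓ)

k+g≤optCost : ∀ k {g} → 1 ≤ g → k + g ≤ optCost (suc k) g
k+g≤optCost k {suc g} _ = ≤-reflexive (+-suc k g)

-- The order on letters

module _ {n r : ℕ} where

  private
    L : Set
    L = Letter n r

  infix 4 _≺_ _⪯_

  -- A data type rather than x ≺ᵇ y ≡ true, so that x and y can be read off a proof.
  data _≺_ (x y : L) : Set where
    ≺-intro : x ≺ᵇ y ≡ true → x ≺ y

  ≺⇒≺ᵇ : ∀ {x y} → x ≺ y → x ≺ᵇ y ≡ true
  ≺⇒≺ᵇ (≺-intro h) = h

  _⪯_ : L → L → Set
  x ⪯ y = x ≡ y ⊎ x ≺ y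

  private
    LexLt : L → L → Set
    LexLt (i , j) (i' , j') = toℕ j' < toℕ j ⊎ (toℕ j ≡ toℕ j' × toℕ i < toℕ i')

    ≺⇒LexLt : ∀ {x y} → x ≺ y → LexLt x y
    ≺⇒LexLt {i , j} {i' , j'} (≺-intro h) =
      Sum.map (<ᵇ⇒< _ _) (Product.map (≡ᵇ⇒≡ _ _) (<ᵇ⇒< _ _) ∘ Equivalence.to T-∧)
        (Equivalence.to (T-∨ {toℕ j' <ᵇ toℕ j}) (Equivalence.from T-≡ h))

    LexLt⇒≺ : ∀ {x y} → LexLt x y → x ≺ y
    LexLt⇒≺ {i , j} {i' , j'} h = ≺-intro (Equivalence.to T-≡ (Equivalence.from (T-∨ {toℕ j' <ᵇ toℕ j})
      (Sum.map <⇒<ᵇ (λ (j≡j' , i<i') → Equivalence.from T-∧ (≡⇒≡ᵇ _ _ j≡j' , <⇒<ᵇ i<i')) h)))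

  ≺-irrefl : ∀ {x} → ¬ x ≺ x
  ≺-irrefl x≺x with ≺⇒LexLt x≺x
  ... | inj₁ j<j = <-irrefl refl j<j
  ... | inj₂ (_ , i<i) = <-irrefl refl i<i

  ≺-trans : Transitive _≺_
  ≺-trans x≺y y≺z = LexLt⇒≺ (lex-trans (≺⇒LexLt x≺y) (≺⇒LexLt y≺z))
    where
    lex-trans : ∀ {x y z} → LexLt x y → LexLt y z → LexLt x z
    lex-trans (inj₁ p) (inj₁ q) = inj₁ (<-trans q p)
    lex-trans (inj₁ p) (inj₂ (e , _)) = inj₁ (subst (_< _) e p)
    lex-trans (inj₂ (e , _)) (inj₁ q) = inj₁ (subst (_ <_) (sym e) q)
    lex-trans (inj₂ (e , p)) (inj₂ (e' , q)) = inj₂ (trans e e' , <-trans p q)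

  ≺-asym : Asymmetric _≺_
  ≺-asym x≺y y≺x = ≺-irrefl (≺-trans x≺y y≺x)

  ≺-trichotomy : ∀ x y → x ≺ y ⊎ x ≡ y ⊎ y ≺ x
  ≺-trichotomy (i , j) (i' , j') with <-cmp (toℕ j) (toℕ j')
  ... | tri< j<j' _ _ = inj₂ (inj₂ (LexLt⇒≺ (inj₁ j<j')))
  ... | tri> _ _ j>j' = inj₁ (LexLt⇒≺ (inj₁ j>j'))
  ... | tri≈ _ j≡j' _ with <-cmp (toℕ i) (toℕ i')
  ...   | tri< i<i' _ _ = inj₁ (LexLt⇒≺ (inj₂ (j≡j' , i<i')))
  ...   | tri≈ _ i≡i' _ = inj₂ (inj₁ (cong₂ _,_ (toℕ-injective i≡i') (toℕ-injective j≡j')))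
  ...   | tri> _ _ i>i' = inj₂ (inj₂ (LexLt⇒≺ (inj₂ (sym j≡j' , i>i'))))

  ≺⇒≻ᵇ-false : ∀ {x y} → x ≺ y → y ≺ᵇ x ≡ false
  ≺⇒≻ᵇ-false x≺y = ¬-not (λ y≺ᵇx → ≺-asym x≺y (≺-intro y≺ᵇx))

  ≺ᵇ-false⇒⪰ : ∀ {x y} → x ≺ᵇ y ≡ false → y ⪯ x
  ≺ᵇ-false⇒⪰ {x} {y} x⊀y with ≺-trichotomy x y
  ... | inj₁ (≺-intro x≺y) = ⊥-elim (true≢false (trans (sym x≺y) x⊀y))
  ... | inj₂ (inj₁ x≡y) = inj₁ (sym x≡y)
  ... | inj₂ (inj₂ y≺x) = inj₂ y≺x

  ≢∧⪯⇒≺ : ∀ {x y} → x ≢ y → x ⪯ y → x ≺ y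
  ≢∧⪯⇒≺ x≢y (inj₁ x≡y) = ⊥-elim (x≢y x≡y)
  ≢∧⪯⇒≺ x≢y (inj₂ x≺y) = x≺y

  ≺-⪯-trans : ∀ {x y z} → x ≺ y → y ⪯ z → x ≺ z
  ≺-⪯-trans x≺y (inj₁ refl) = x≺y
  ≺-⪯-trans x≺y (inj₂ y≺z) = ≺-trans x≺y y≺z

  ⪯-≺-trans : ∀ {x y z} → x ⪯ y → y ≺ z → x ≺ z
  ⪯-≺-trans (inj₁ refl) y≺z = y≺z
  ⪯-≺-trans (inj₂ x≺y) y≺z = ≺-trans x≺y y≺z

  -- Sorted and rotated blocks

  insert-↭ : ∀ (x : L) ys → insert x ys ↭ x ∷ ys
  insert-↭ x [] = ↭-refl
  insert-↭ x (y ∷ ys) with y ≺ᵇ x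
  ... | true = ↭-trans (prep y (insert-↭ x ys)) (swap y x ↭-refl)
  ... | false = ↭-refl

  sortL-↭ : ∀ (xs : List L) → sortL xs ↭ xs
  sortL-↭ [] = ↭-refl
  sortL-↭ (x ∷ xs) = ↭-trans (insert-↭ x (sortL xs)) (prep x (sortL-↭ xs))

  insert-sorted : ∀ {x : L} {ys} → All (x ≢_) ys → AllPairs _≺_ ys → AllPairs _≺_ (insert x ys)
  insert-sorted {x} {[]} _ _ = [] ∷ []
  insert-sorted {x} {y ∷ ys} (x≢y ∷ x≢ys) (y≺ys ∷ ys↑) with y ≺ᵇ x in y≺ᵇx
  ... | true = All-resp-↭ (↭-sym (insert-↭ x ys)) (≺-intro y≺ᵇx ∷ y≺ys) ∷ insert-sorted x≢ys ys↑
  ... | false = AllPairs-∷-trans ≺-trans (≢∧⪯⇒≺ x≢y (≺ᵇ-false⇒⪰ y≺ᵇx)) (y≺ys ∷ ys↑)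

  sortL-sorted : ∀ {xs : List L} → Unique xs → AllPairs _≺_ (sortL xs)
  sortL-sorted {[]} [] = []
  sortL-sorted {x ∷ xs} (x∉xs ∷ xs!) =
    insert-sorted (All-resp-↭ (↭-sym (sortL-↭ xs)) x∉xs) (sortL-sorted xs!)

  -- The order in which π[s] lists its letters when π[s+1] starts with ρ:
  -- first the letters above ρ, then the others, each group increasing.
  data RotatedLt (ρ a b : L) : Set where
    across : ρ ≺ᵇ a ≡ true → ρ ≺ᵇ b ≡ false → RotatedLt ρ a b
    within : ρ ≺ᵇ a ≡ ρ ≺ᵇ b → a ≺ b → RotatedLt ρ a b

  RotatedLt-trans : ∀ {ρ} → Transitive (RotatedLt ρ)
  RotatedLt-trans (across a↑ b↓) (across b↑ _) = ⊥-elim (true≢false (trans (sym b↑) b↓))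
  RotatedLt-trans (across a↑ b↓) (within b≈c _) = across a↑ (trans (sym b≈c) b↓)
  RotatedLt-trans (within a≈b _) (across b↑ c↓) = across (trans a≈b b↑) c↓
  RotatedLt-trans (within a≈b a≺b) (within b≈c b≺c) = within (trans a≈b b≈c) (≺-trans a≺b b≺c)

  RotatedLt-asym : ∀ {ρ} → Asymmetric (RotatedLt ρ)
  RotatedLt-asym (across a↑ b↓) (across b↑ _) = true≢false (trans (sym b↑) b↓)
  RotatedLt-asym (across a↑ b↓) (within b≈a _) = true≢false (trans (sym a↑) (trans (sym b≈a) b↓))
  RotatedLt-asym (within a≈b _) (across b↑ a↓) = true≢false (trans (sym b↑) (trans (sym a≈b) a↓))
  RotatedLt-asym (within _ a≺b) (within _ b≺a) = ≺-asym a≺b b≺a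

  sameSide⇒RotatedLt : ∀ {ρ side} {xs : List L} → All (λ a → ρ ≺ᵇ a ≡ side) xs → AllPairs _≺_ xs →
                       AllPairs (RotatedLt ρ) xs
  sameSide⇒RotatedLt [] [] = []
  sameSide⇒RotatedLt (a↕ ∷ xs↕) (a≺xs ∷ xs↑) =
    All.zipWith (λ (b↕ , a≺b) → within (trans a↕ (sym b↕)) a≺b) (xs↕ , a≺xs) ∷ sameSide⇒RotatedLt xs↕ xs↑

  ⪯ᵇ≡≺ᵇ : ∀ {x y : L} → x ≢ y → x ⪯ᵇ y ≡ x ≺ᵇ y
  ⪯ᵇ≡≺ᵇ {x} {y} x≢y with x ≟L y
  ... | yes x≡y = ⊥-elim (x≢y x≡y)
  ... | no _ = ∨-identityʳ (x ≺ᵇ y)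

  module _ (ρ : L) where

    private
      _⪯ρ? : Decidable (λ x → x ⪯ᵇ ρ ≡ true)
      x ⪯ρ? = x ⪯ᵇ ρ Bool.≟ true

    below-takeWhile : ∀ {l} → All (_≢ ρ) l → All (λ x → ρ ≺ᵇ x ≡ false) (takeWhile _⪯ρ? l)
    below-takeWhile {l} l≢ρ =
      All.zipWith (λ {x} (x⪯ρ , x≢ρ) → ≺⇒≻ᵇ-false (≺-intro {x} {ρ} (trans (sym (⪯ᵇ≡≺ᵇ x≢ρ)) x⪯ρ)))
        (All.all-takeWhile _⪯ρ? l , All.takeWhile⁺ _⪯ρ? l≢ρ)

    above-dropWhile : ∀ {l} → AllPairs _≺_ l → All (_≢ ρ) l → All (λ x → ρ ≺ᵇ x ≡ true) (dropWhile _⪯ρ? l)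
    above-dropWhile {[]} _ _ = []
    above-dropWhile {x ∷ l} (x≺l ∷ l↑) (x≢ρ ∷ l≢ρ) with x ⪯ρ?
    ... | yes _ = above-dropWhile l↑ l≢ρ
    ... | no x⋠ρ = ≺⇒≺ᵇ ρ≺x ∷ All.map (≺⇒≺ᵇ ∘ ≺-trans ρ≺x) x≺l
      where
      ρ≺x : ρ ≺ x
      ρ≺x = ≢∧⪯⇒≺ (x≢ρ ∘ sym) (≺ᵇ-false⇒⪰ (trans (sym (⪯ᵇ≡≺ᵇ x≢ρ)) (¬-not x⋠ρ)))

    rotateBy-↭ : ∀ l → rotateBy ρ l ↭ l
    rotateBy-↭ l = ↭-trans (++-comm (dropWhile _⪯ρ? l) (takeWhile _⪯ρ? l))
                           (↭-reflexive (takeWhile++dropWhile _⪯ρ? l))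

    rotateBy-RotatedLt : ∀ {l} → AllPairs _≺_ l → All (_≢ ρ) l → AllPairs (RotatedLt ρ) (rotateBy ρ l)
    rotateBy-RotatedLt {l} l↑ l≢ρ =
      AllPairs.++⁺ (sameSide⇒RotatedLt above drop↑) (sameSide⇒RotatedLt below take↑)
                   (All.map (λ a↑ → All.map (across a↑) below) above)
      where
      above : All (λ x → ρ ≺ᵇ x ≡ true) (dropWhile _⪯ρ? l)
      above = above-dropWhile l↑ l≢ρ

      below : All (λ x → ρ ≺ᵇ x ≡ false) (takeWhile _⪯ρ? l)
      below = below-takeWhile l≢ρ

      take++drop↑ : AllPairs _≺_ (takeWhile _⪯ρ? l ++ dropWhile _⪯ρ? l)
      take++drop↑ = subst (AllPairs _≺_) (sym (takeWhile++dropWhile _⪯ρ? l)) l↑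

      take↑ : AllPairs _≺_ (takeWhile _⪯ρ? l)
      take↑ = proj₁ (AllPairs-++⁻ (takeWhile _⪯ρ? l) take++drop↑)

      drop↑ : AllPairs _≺_ (dropWhile _⪯ρ? l)
      drop↑ = proj₁ (proj₂ (AllPairs-++⁻ (takeWhile _⪯ρ? l) take++drop↑))

  rotatedBlock : L → List L → List L
  rotatedBlock ρ B = rotateBy ρ (sortL B)

  rotatedBlock-↭ : ∀ ρ (B : List L) → rotatedBlock ρ B ↭ B
  rotatedBlock-↭ ρ B = ↭-trans (rotateBy-↭ ρ (sortL B)) (sortL-↭ B)

  rotatedBlock-RotatedLt : ∀ {ρ B} → Unique B → All (_≢ ρ) B → AllPairs (RotatedLt ρ) (rotatedBlock ρ B)
  rotatedBlock-RotatedLt {ρ} {B} B! B≢ρ =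
    rotateBy-RotatedLt ρ (sortL-sorted B!) (All-resp-↭ (↭-sym (sortL-↭ B)) B≢ρ)

  -- Descent sums of a block

  blockCost : ℕ → List L → L → ℕ
  blockCost k u y = desSum k (u ++ [ y ])

  desSum-++ : ∀ k (x : L) u y ys →
    desSum k ((x ∷ u) ++ y ∷ ys) ≡ blockCost k (x ∷ u) y + desSum (k + length (x ∷ u)) (y ∷ ys)
  desSum-++ k x [] y ys rewrite +-identityʳ (if y ≺ᵇ x then k else 0) | +-comm k 1 = refl
  desSum-++ k x (x' ∷ u) y ys = begin
    d + desSum (suc k) ((x' ∷ u) ++ y ∷ ys)
      ≡⟨ cong (d +_) (desSum-++ (suc k) x' u y ys) ⟩
    d + (blockCost (suc k) (x' ∷ u) y + desSum (suc k + length (x' ∷ u)) (y ∷ ys))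
      ≡⟨ sym (+-assoc d _ _) ⟩
    d + blockCost (suc k) (x' ∷ u) y + desSum (suc k + length (x' ∷ u)) (y ∷ ys)
      ≡⟨ cong (λ m → d + blockCost (suc k) (x' ∷ u) y + desSum m (y ∷ ys)) (sym (+-suc k _)) ⟩
    d + blockCost (suc k) (x' ∷ u) y + desSum (k + length (x ∷ x' ∷ u)) (y ∷ ys) ∎
    where
    open ≡-Reasoning
    d : ℕ
    d = if x' ≺ᵇ x then k else 0

  desSum-sorted : ∀ k {u : List L} → AllPairs _≺_ u → desSum k u ≡ 0
  desSum-sorted k {[]} _ = refl
  desSum-sorted k {x ∷ []} _ = refl
  desSum-sorted k {x ∷ x' ∷ u} ((x≺x' ∷ _) ∷ x'u↑) rewrite ≺⇒≻ᵇ-false x≺x' = desSum-sorted (suc k) x'u↑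

  desSum<k⇒sorted : ∀ {k} {u : List L} → Unique u → desSum k u < k → AllPairs _≺_ u
  desSum<k⇒sorted {k} {[]} _ _ = []
  desSum<k⇒sorted {k} {x ∷ []} _ _ = [] ∷ []
  desSum<k⇒sorted {k} {x ∷ x' ∷ u} ((x≢x' ∷ _) ∷ x'u!) d<k with x' ≺ᵇ x in x'≺ᵇx
  ... | true = ⊥-elim (<-irrefl refl (≤-trans d<k (m≤m+n k _)))
  ... | false = AllPairs-∷-trans ≺-trans (≢∧⪯⇒≺ x≢x' (≺ᵇ-false⇒⪰ x'≺ᵇx))
                  (desSum<k⇒sorted x'u! (≤-trans d<k (n≤1+n k)))

  countAbove : L → List L → ℕ
  countAbove y xs = sum (map (λ x → if y ≺ᵇ x then 1 else 0) xs)

  countAbove-↭ : ∀ {y} {xs ys : List L} → xs ↭ ys → countAbove y xs ≡ countAbove y ys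
  countAbove-↭ p = sum-↭ (Perm.map⁺ _ p)

  countAbove≤length : ∀ y (xs : List L) → countAbove y xs ≤ length xs
  countAbove≤length y [] = z≤n
  countAbove≤length y (x ∷ xs) with y ≺ᵇ x
  ... | true = s≤s (countAbove≤length y xs)
  ... | false = m≤n⇒m≤1+n (countAbove≤length y xs)

  countAbove-antitone : ∀ {y y'} → y' ⪯ y → ∀ (xs : List L) → countAbove y xs ≤ countAbove y' xs
  countAbove-antitone y'⪯y [] = z≤n
  countAbove-antitone {y} {y'} y'⪯y (x ∷ xs) with y ≺ᵇ x in y≺ᵇx | y' ≺ᵇ x in y'≺ᵇx
  ... | true | true = s≤s (countAbove-antitone y'⪯y xs)
  ... | true | false =
        ⊥-elim (true≢false (trans (sym (≺⇒≺ᵇ (⪯-≺-trans y'⪯y (≺-intro {y} {x} y≺ᵇx)))) y'≺ᵇx))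
  ... | false | true = m≤n⇒m≤1+n (countAbove-antitone y'⪯y xs)
  ... | false | false = countAbove-antitone y'⪯y xs

  countAbove-pos : ∀ {y z} {xs : List L} → z ∈ xs → y ≺ z → 1 ≤ countAbove y xs
  countAbove-pos (here refl) (≺-intro y≺ᵇz) rewrite y≺ᵇz = s≤s z≤n
  countAbove-pos {y} {xs = x ∷ _} (there z∈xs) y≺z =
    ≤-trans (countAbove-pos z∈xs y≺z) (m≤n+m _ (if y ≺ᵇ x then 1 else 0))

  countAbove-none : ∀ {y} {xs : List L} → All (λ z → y ≺ᵇ z ≡ false) xs → countAbove y xs ≡ 0
  countAbove-none [] = refl
  countAbove-none {y} (y⊀x ∷ y⊀xs) rewrite y⊀x = countAbove-none {y} y⊀xs

  below≺above : ∀ {y x x' : L} → y ≺ᵇ x' ≡ false → x' ≢ y → y ≺ᵇ x ≡ true → x' ≺ᵇ x ≡ true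
  below≺above {y} {x} y⊀x' x'≢y y≺ᵇx =
    ≺⇒≺ᵇ (≺-trans (≢∧⪯⇒≺ x'≢y (≺ᵇ-false⇒⪰ y⊀x')) (≺-intro {y} {x} y≺ᵇx))

  RotatedLt-below : ∀ {ρ a b : L} → ρ ≺ᵇ a ≡ false → RotatedLt ρ a b → ρ ≺ᵇ b ≡ false
  RotatedLt-below ρ⊀a (across ρ≺a _) = ⊥-elim (true≢false (trans (sym ρ≺a) ρ⊀a))
  RotatedLt-below ρ⊀a (within a≈b _) = trans (sym a≈b) ρ⊀a

  countAbove-rotated-below : ∀ {ρ a : L} {l} → ρ ≺ᵇ a ≡ false → All (RotatedLt ρ a) l →
                             countAbove ρ (a ∷ l) ≡ 0
  countAbove-rotated-below {ρ} {a} {l} ρ⊀a a↻l =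
    countAbove-none {ρ} {a ∷ l} (ρ⊀a ∷ All.map (RotatedLt-below {ρ} {a} ρ⊀a) a↻l)

  optCost≤blockCost : ∀ k {y} (u : List L) → All (_≢ y) u → optCost k (countAbove y u) ≤ blockCost k u y
  optCost≤blockCost k [] _ = z≤n
  optCost≤blockCost k {y} (x ∷ []) _ with y ≺ᵇ x
  ... | true = ≤-refl
  ... | false = z≤n
  optCost≤blockCost k {y} (x ∷ x' ∷ u) (_ ∷ x'≢y ∷ u≢y)
    with y ≺ᵇ x in y≺ᵇx | y ≺ᵇ x' in y≺ᵇx' | x' ≺ᵇ x in x'≺ᵇx
       | optCost≤blockCost (suc k) (x' ∷ u) (x'≢y ∷ u≢y)
  ... | true | true | _ | ih = ≤-trans (≤-reflexive (sym (optCost-suc k _))) (≤-trans ih (m≤n+m _ _))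
  ... | true | false | true | ih = +-monoʳ-≤ k (≤-trans (g≤optCost k _) ih)
  ... | true | false | false | _ =
        ⊥-elim (true≢false (trans (sym (below≺above {y} {x} {x'} y≺ᵇx' x'≢y y≺ᵇx)) x'≺ᵇx))
  ... | false | b | _ | ih =
        ≤-trans (optCost-monoˡ k ((if b then 1 else 0) + countAbove y u)) (≤-trans ih (m≤n+m _ _))

  blockCost-rotated : ∀ k {y} {u : List L} → AllPairs (RotatedLt y) u → All (_≢ y) u →
                      blockCost k u y ≤ optCost k (countAbove y u)
  blockCost-rotated k {y} {[]} _ _ = z≤n
  blockCost-rotated k {y} {x ∷ []} _ _ with y ≺ᵇ x
  ... | true = ≤-refl
  ... | false = ≤-refl
  blockCost-rotated k {y} {x ∷ x' ∷ u} ((across y≺ᵇx y⊀x' ∷ _) ∷ x'u↻@(x'↻u ∷ _)) (_ ∷ x'u≢y@(x'≢y ∷ _))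
    with blockCost-rotated (suc k) x'u↻ x'u≢y
  ... | ih rewrite y≺ᵇx | below≺above {y} {x} {x'} y⊀x' x'≢y y≺ᵇx =
        +-monoʳ-≤ k (≤-trans (subst (λ g → blockCost (suc k) (x' ∷ u) y ≤ optCost (suc k) g)
                                    (countAbove-rotated-below {y} y⊀x' x'↻u) ih)
                             z≤n)
  blockCost-rotated k {y} {x ∷ x' ∷ u} ((within y↕ x≺x' ∷ _) ∷ x'u↻@(x'↻u ∷ _)) (_ ∷ x'u≢y)
    rewrite ≺⇒≻ᵇ-false x≺x'
    with y ≺ᵇ x | y ≺ᵇ x' in y≺ᵇx' | y↕ | blockCost-rotated (suc k) x'u↻ x'u≢y
  ... | true | true | refl | ih = ≤-trans ih (≤-reflexive (optCost-suc k _))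
  ... | false | false | refl | ih =
        ≤-trans (subst (λ g → blockCost (suc k) (x' ∷ u) y ≤ optCost (suc k) g)
                       (countAbove-none {y} (All.map (RotatedLt-below {y} {x'} y≺ᵇx') x'↻u)) ih)
                z≤n

  blockCost≤optCost⇒RotatedLt : ∀ {k} → 1 ≤ k → ∀ {y} {u : List L} → Unique u → All (_≢ y) u →
    blockCost k u y ≤ optCost k (countAbove y u) → AllPairs (RotatedLt y) u
  blockCost≤optCost⇒RotatedLt _ {y} {[]} _ _ _ = []
  blockCost≤optCost⇒RotatedLt _ {y} {x ∷ []} _ _ _ = [] ∷ []
  blockCost≤optCost⇒RotatedLt {k} 1≤k {y} {x ∷ x' ∷ u} ((x≢x' ∷ _) ∷ x'u!) (_ ∷ x'u≢y@(x'≢y ∷ _)) c≤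
    with y ≺ᵇ x in y≺ᵇx | y ≺ᵇ x' in y≺ᵇx' | x' ≺ᵇ x in x'≺ᵇx
       | optCost≤blockCost (suc k) (x' ∷ u) x'u≢y
       | blockCost≤optCost⇒RotatedLt (≤-trans 1≤k (n≤1+n k)) x'u! x'u≢y
  ... | true | true | true | lb | _ =
        ⊥-elim (<⇒≱ (m<n+m _ 1≤k)
                    (≤-trans c≤ (≤-trans (≤-reflexive (sym (optCost-suc k (countAbove y u)))) lb)))
  ... | true | true | false | _ | ih =
        AllPairs-∷-trans RotatedLt-trans (within (trans y≺ᵇx (sym y≺ᵇx')) (≢∧⪯⇒≺ x≢x' (≺ᵇ-false⇒⪰ x'≺ᵇx)))
          (ih (≤-trans c≤ (≤-reflexive (sym (optCost-suc k (countAbove y u))))))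
  ... | true | false | true | _ | ih =
        AllPairs-∷-trans RotatedLt-trans (across y≺ᵇx y≺ᵇx')
          (ih (≤-trans (+-cancelˡ-≤ k _ _ c≤) (g≤optCost k (countAbove y u))))
  ... | true | false | false | _ | _ =
        ⊥-elim (true≢false (trans (sym (below≺above {y} {x} {x'} y≺ᵇx' x'≢y y≺ᵇx)) x'≺ᵇx))
  ... | false | true | d | lb | _ =
        ⊥-elim (<-irrefl refl (≤-trans (optCost-<-suc k (countAbove y u))
                                       (≤-trans lb (≤-trans (m≤n+m _ (if d then k else 0)) c≤))))
  ... | false | false | true | lb | _ =
        ⊥-elim (<⇒≱ (m<n+m _ 1≤k) (≤-trans c≤ (≤-trans (optCost-monoˡ k (countAbove y u)) lb)))
  ... | false | false | false | _ | ih =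
        AllPairs-∷-trans RotatedLt-trans (within (trans y≺ᵇx (sym y≺ᵇx')) (≢∧⪯⇒≺ x≢x' (≺ᵇ-false⇒⪰ x'≺ᵇx)))
          (ih (≤-trans c≤ (optCost-monoˡ k (countAbove y u))))

  k≤desSum-of-later-smaller : ∀ k {x z : L} {u} t → z ∈ u → z ≺ x → k ≤ desSum k ((x ∷ u) ++ t)
  k≤desSum-of-later-smaller k {x} {z} {x' ∷ u} t z∈x'u z≺x with x' ≺ᵇ x in x'≺ᵇx | z∈x'u
  ... | true | _ = m≤m+n k _
  ... | false | here refl = ⊥-elim (true≢false (trans (sym (≺⇒≺ᵇ z≺x)) x'≺ᵇx))
  ... | false | there z∈u =
        ≤-trans (n≤1+n k) (k≤desSum-of-later-smaller (suc k) t z∈u (≺-⪯-trans z≺x (≺ᵇ-false⇒⪰ x'≺ᵇx)))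

  -- The descent leading down towards z and the last descent, which comes after all letters
  -- above y, are distinct.
  2k+countAbove≤blockCost : ∀ k {x z y y' : L} {u} → z ∈ u → z ≺ x → y ≺ z → y' ⪯ y → All (_≢ y') u →
                            k + (k + countAbove y u) ≤ blockCost k (x ∷ u) y'
  2k+countAbove≤blockCost k {x} {z} {y} {y'} {x' ∷ u} z∈x'u z≺x y≺z y'⪯y x'u≢y'@(_ ∷ u≢y')
    with x' ≺ᵇ x in x'≺ᵇx | z∈x'u
  ... | true | _ =
        +-monoʳ-≤ k (≤-trans (k+g≤optCost k (countAbove-pos z∈x'u y≺z))
                     (≤-trans (optCost-monoʳ (suc k) (countAbove-antitone y'⪯y (x' ∷ u)))
                              (optCost≤blockCost (suc k) (x' ∷ u) x'u≢y')))
  ... | false | here refl = ⊥-elim (true≢false (trans (sym (≺⇒≺ᵇ z≺x)) x'≺ᵇx))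
  ... | false | there z∈u rewrite ≺⇒≺ᵇ (≺-trans y≺z (≺-⪯-trans z≺x (≺ᵇ-false⇒⪰ {x'} {x} x'≺ᵇx))) =
        ≤-trans (+-mono-≤ (n≤1+n k) (≤-reflexive (+-suc k (countAbove y u))))
                (2k+countAbove≤blockCost (suc k) z∈u (≺-⪯-trans z≺x (≺ᵇ-false⇒⪰ x'≺ᵇx)) y≺z y'⪯y u≢y')

  k+optCost≤blockCost : ∀ k {x z y y' : L} {u} → z ∈ u → z ≺ x → y ≺ z ⊎ countAbove y (x ∷ u) ≡ 0 →
                        y' ⪯ y → All (_≢ y') u → k + optCost k (countAbove y (x ∷ u)) ≤ blockCost k (x ∷ u) y'
  k+optCost≤blockCost k z∈u z≺x (inj₁ y≺z) y'⪯y u≢y' rewrite ≺⇒≺ᵇ (≺-trans y≺z z≺x) =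
    2k+countAbove≤blockCost k z∈u z≺x y≺z y'⪯y u≢y'
  k+optCost≤blockCost k {x} {y' = y'} {u} z∈u z≺x (inj₂ none) _ _ =
    subst (λ g → k + optCost k g ≤ blockCost k (x ∷ u) y') (sym none)
          (≤-trans (≤-reflexive (+-identityʳ k)) (k≤desSum-of-later-smaller k [ y' ] z∈u z≺x))

  -- Comparison with π(σ) block by block

  piBlocks-↭ : ∀ (σ : List (List L)) → Pointwise _↭_ (piBlocks σ) σ
  piBlocks-↭ [] = []
  piBlocks-↭ (B ∷ rest) with piBlocks rest | piBlocks-↭ rest
  ... | ps | ps↭ with firstLetter ps
  ... | nothing = sortL-↭ B ∷ ps↭
  ... | just ρ = rotatedBlock-↭ ρ B ∷ ps↭

  concat-↭ : ∀ {ws σ : List (List L)} → Pointwise _↭_ ws σ → concat ws ↭ concat σ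
  concat-↭ [] = ↭-refl
  concat-↭ (w↭B ∷ ws↭) = ++⁺ w↭B (concat-↭ ws↭)

  piσ-↭ : ∀ (σ : List (List L)) → piσ σ ↭ concat σ
  piσ-↭ σ = concat-↭ (piBlocks-↭ σ)

  piσ-∷ : ∀ (B : List L) {B' rest} → B' ≢ [] →
          Σ L λ ρ → Σ (List L) λ Π → piσ (B' ∷ rest) ≡ ρ ∷ Π × piσ (B ∷ B' ∷ rest) ≡ rotatedBlock ρ B ++ ρ ∷ Π
  piσ-∷ B {B'} {rest} B'≢[] with piBlocks (B' ∷ rest) | piBlocks-↭ (B' ∷ rest)
  ... | [] ∷ _ | []↭B' ∷ _ = ⊥-elim (B'≢[] (↭-empty-inv (↭-sym []↭B')))
  ... | (ρ ∷ p) ∷ ps | _ = ρ , p ++ concat ps , refl , refl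

  _⪯ʰ_ : List L → List L → Set
  (a ∷ _) ⪯ʰ (b ∷ _) = a ⪯ b
  _ ⪯ʰ _ = ⊤

  -- Either p beats w by at least k, more than the whole cost of a block of π(σ) ending at
  -- position k - 1, or p beats w and w does not start with a larger letter than p, so that the
  -- block of w before it has a follower no larger than that of the corresponding block of π(σ).
  Dominates : ℕ → List L → List L → Set
  Dominates k p w = k + desSum k p ≤ desSum k w ⊎ (desSum k p < desSum k w × w ⪯ʰ p)

  module DominatesStep {k : ℕ} (1≤k : 1 ≤ k) {B : List L} {x o y ρ : L} {u o' w p : List L}
    (B! : Unique B) (xu↭B : x ∷ u ↭ B) (oo'↭B : o ∷ o' ↭ B) (oo'↻ : AllPairs (RotatedLt ρ) (o ∷ o'))
    (B≢y : All (_≢ y) B) (B≢ρ : All (_≢ ρ) B)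
    (differ : (x ∷ u) ++ y ∷ w ≢ (o ∷ o') ++ ρ ∷ p)
    where

    k' : ℕ
    k' = k + length (x ∷ u)

    blockW blockπ restW restπ g : ℕ
    blockW = blockCost k (x ∷ u) y
    blockπ = blockCost k (o ∷ o') ρ
    restW = desSum k' (y ∷ w)
    restπ = desSum k' (ρ ∷ p)
    g = countAbove ρ (x ∷ u)

    oo'↭xu : o ∷ o' ↭ x ∷ u
    oo'↭xu = ↭-trans oo'↭B (↭-sym xu↭B)

    xu-avoids : ∀ {z} → All (_≢ z) B → All (_≢ z) (x ∷ u)
    xu-avoids = All-resp-↭ (↭-sym xu↭B)

    blockπ≤optCost : blockπ ≤ optCost k g
    blockπ≤optCost = subst (λ h → blockπ ≤ optCost k h) (countAbove-↭ {ρ} oo'↭xu)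
                       (blockCost-rotated k {ρ} oo'↻ (All-resp-↭ (↭-sym oo'↭B) B≢ρ))

    blockπ<k' : blockπ < k'
    blockπ<k' = ≤-<-trans blockπ≤optCost (optCost<k+ 1≤k (countAbove≤length ρ (x ∷ u)))

    blockπ≤blockCost : ∀ {y'} → y' ⪯ ρ → All (_≢ y') B → blockπ ≤ blockCost k (x ∷ u) y'
    blockπ≤blockCost y'⪯ρ B≢y' =
      ≤-trans blockπ≤optCost (≤-trans (optCost-monoʳ k (countAbove-antitone y'⪯ρ (x ∷ u)))
                                  (optCost≤blockCost k (x ∷ u) (xu-avoids B≢y')))

    o∈u : o ≺ x → o ∈ u
    o∈u o≺x with ∈-resp-↭ oo'↭xu (here refl)
    ... | here o≡x = ⊥-elim (≺-irrefl (subst (o ≺_) (sym o≡x) o≺x))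
    ... | there o∈u = o∈u

    ρ≺o⊎none-above : ρ ≺ o ⊎ g ≡ 0
    ρ≺o⊎none-above with ρ ≺ᵇ o in ρ≺ᵇo
    ... | true = inj₁ (≺-intro ρ≺ᵇo)
    ... | false = inj₂ (trans (sym (countAbove-↭ {ρ} oo'↭xu))
                              (countAbove-rotated-below {ρ} ρ≺ᵇo (AllPairs.head oo'↻)))

    k+blockπ≤blockCost : o ≺ x → ∀ {y'} → y' ⪯ ρ → All (_≢ y') B → k + blockπ ≤ blockCost k (x ∷ u) y'
    k+blockπ≤blockCost o≺x y'⪯ρ B≢y' =
      ≤-trans (+-monoʳ-≤ k blockπ≤optCost)
              (k+optCost≤blockCost k (o∈u o≺x) o≺x ρ≺o⊎none-above y'⪯ρ (All.tail (xu-avoids B≢y')))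

    blocks-differ : y ≡ ρ → w ≡ p → x ∷ u ≢ o ∷ o'
    blocks-differ refl refl xu≡oo' = differ (cong (_++ y ∷ w) xu≡oo')

    optCost<blockW : y ≡ ρ → w ≡ p → optCost k g < blockW
    optCost<blockW refl w≡p with blockW ≤? optCost k g
    ... | no blockW≰ = ≰⇒> blockW≰
    ... | yes blockW≤ = ⊥-elim (blocks-differ refl w≡p
          (AllPairs-↭⇒≡ RotatedLt-asym
            (blockCost≤optCost⇒RotatedLt 1≤k (Unique-resp-↭ (↭-sym xu↭B) B!) (xu-avoids B≢ρ) blockW≤)
            oo'↻ (↭-sym oo'↭xu)))

    blockπ+restπ≤restW : k' + restπ ≤ restW → blockπ + restπ ≤ restW
    blockπ+restπ≤restW far = ≤-trans (<⇒≤ (+-monoˡ-< restπ blockπ<k')) far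

    Tails : Set
    Tails = (y ≡ ρ × w ≡ p) ⊎ Dominates k' (ρ ∷ p) (y ∷ w)

    strict : Tails → blockπ + restπ < blockW + restW
    strict (inj₁ (refl , refl)) = +-monoˡ-< restπ (≤-<-trans blockπ≤optCost (optCost<blockW refl refl))
    strict (inj₂ (inj₁ far)) = ≤-trans (+-monoˡ-< restπ blockπ<k') (≤-trans far (m≤n+m restW blockW))
    strict (inj₂ (inj₂ (near , y⪯ρ))) = +-mono-≤-< (blockπ≤blockCost y⪯ρ B≢y) near

    margin : o ≺ x → Tails → k + (blockπ + restπ) ≤ blockW + restW
    margin o≺x (inj₁ (refl , refl)) =
      subst (_≤ blockW + restW) (+-assoc k blockπ restπ)
            (+-monoˡ-≤ restπ (k+blockπ≤blockCost o≺x (inj₁ refl) B≢y))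
    margin o≺x (inj₂ (inj₁ far)) =
      +-mono-≤ (k≤desSum-of-later-smaller k [ y ] (o∈u o≺x) o≺x) (blockπ+restπ≤restW far)
    margin o≺x (inj₂ (inj₂ (near , y⪯ρ))) =
      subst (_≤ blockW + restW) (+-assoc k blockπ restπ)
            (+-mono-≤ (k+blockπ≤blockCost o≺x y⪯ρ B≢y) (<⇒≤ near))

    desSum-w : desSum k ((x ∷ u) ++ y ∷ w) ≡ blockW + restW
    desSum-w = desSum-++ k x u y w

    desSum-p : desSum k ((o ∷ o') ++ ρ ∷ p) ≡ blockπ + restπ
    desSum-p = trans (desSum-++ k o o' ρ p)
                     (cong (λ m → blockπ + desSum (k + m) (ρ ∷ p)) (↭-length oo'↭xu))

    dominates : Tails → Dominates k ((o ∷ o') ++ ρ ∷ p) ((x ∷ u) ++ y ∷ w)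
    dominates tails = subst₂ (λ P W → k + P ≤ W ⊎ (P < W × x ⪯ o)) (sym desSum-p) (sym desSum-w)
                             (by-heads (≺-trichotomy x o))
      where
      by-heads : x ≺ o ⊎ x ≡ o ⊎ o ≺ x →
                 k + (blockπ + restπ) ≤ blockW + restW ⊎ (blockπ + restπ < blockW + restW × x ⪯ o)
      by-heads (inj₁ x≺o) = inj₂ (strict tails , inj₂ x≺o)
      by-heads (inj₂ (inj₁ x≡o)) = inj₂ (strict tails , inj₁ x≡o)
      by-heads (inj₂ (inj₂ o≺x)) = inj₁ (margin o≺x tails)

  dominates-∷ : ∀ {k} → 1 ≤ k → ∀ {B ob : List L} {x y ρ : L} {u w p} →
    Unique B → x ∷ u ↭ B → ob ↭ B → AllPairs (RotatedLt ρ) ob → All (_≢ y) B → All (_≢ ρ) B →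
    (y ∷ w ≢ ρ ∷ p → Dominates (k + length (x ∷ u)) (ρ ∷ p) (y ∷ w)) →
    (x ∷ u) ++ y ∷ w ≢ ob ++ ρ ∷ p → Dominates k (ob ++ ρ ∷ p) ((x ∷ u) ++ y ∷ w)
  dominates-∷ _ {ob = []} _ xu↭B []↭B = ⊥-elim (¬x∷xs↭[] (↭-trans xu↭B (↭-sym []↭B)))
  dominates-∷ {k} 1≤k {ob = o ∷ o'} {x} {y} {ρ} {u} {w} {p}
              B! xu↭B ob↭B ob↻ B≢y B≢ρ tail-dominates differ =
    DominatesStep.dominates 1≤k B! xu↭B ob↭B ob↻ B≢y B≢ρ differ tails
    where
    tails : (y ≡ ρ × w ≡ p) ⊎ Dominates (k + length (x ∷ u)) (ρ ∷ p) (y ∷ w)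
    tails with ≡-dec _≟L_ (y ∷ w) (ρ ∷ p)
    ... | yes eq = inj₁ (∷-injectiveˡ eq , ∷-injectiveʳ eq)
    ... | no ne = inj₂ (tail-dominates ne)

  k≤desSum-unsorted : ∀ k {u : List L} → Unique u → ¬ AllPairs _≺_ u → k ≤ desSum k u
  k≤desSum-unsorted k u! unsorted = ≮⇒≥ (unsorted ∘ desSum<k⇒sorted u!)

  sortL-dominates : ∀ k {B u : List L} → Unique B → u ↭ B → u ≢ sortL B →
                    k + desSum k (sortL B) ≤ desSum k u
  sortL-dominates k {B} {u} B! u↭B u≢sorted = begin
    k + desSum k (sortL B) ≡⟨ cong (k +_) (desSum-sorted k (sortL-sorted B!)) ⟩
    k + 0                  ≡⟨ +-identityʳ k ⟩
    k                      ≤⟨ k≤desSum-unsorted k (Unique-resp-↭ (↭-sym u↭B) B!) u-unsorted ⟩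
    desSum k u             ∎
    where
    open ≤-Reasoning
    u-unsorted : ¬ AllPairs _≺_ u
    u-unsorted u↑ = u≢sorted (AllPairs-↭⇒≡ ≺-asym u↑ (sortL-sorted B!) (↭-trans u↭B (↭-sym (sortL-↭ B))))

  piσ-dominates : ∀ {k} → 1 ≤ k → ∀ (σ : List (List L)) {ws} → All (_≢ []) σ → Unique (concat σ) →
                  Pointwise _↭_ ws σ → concat ws ≢ piσ σ → Dominates k (piσ σ) (concat ws)
  piσ-dominates _ [] _ _ [] differ = ⊥-elim (differ refl)
  piσ-dominates {k} _ (B ∷ []) _ B! (_∷_ {x = u} u↭B []) differ =
    inj₁ (subst₂ (λ π w → k + desSum k π ≤ desSum k w)
                 (sym (++-identityʳ (sortL B))) (sym (++-identityʳ u))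
           (sortL-dominates k (proj₁ (AllPairs-++⁻ B B!)) u↭B (differ ∘ cong (_++ []))))
  piσ-dominates _ (B ∷ _ ∷ _) {[] ∷ _} (B≢[] ∷ _) _ ([]↭B ∷ _) _ =
    ⊥-elim (B≢[] (↭-empty-inv (↭-sym []↭B)))
  piσ-dominates _ (_ ∷ B' ∷ _) {_ ∷ [] ∷ _} (_ ∷ B'≢[] ∷ _) _ (_ ∷ []↭B' ∷ _) _ =
    ⊥-elim (B'≢[] (↭-empty-inv (↭-sym []↭B')))
  piσ-dominates {k} 1≤k (B ∷ B' ∷ rest) {(x ∷ u) ∷ (y ∷ v) ∷ vs}
                (_ ∷ B'rest≢[]@(B'≢[] ∷ _)) σ! (xu↭B ∷ vvs↭) differ
    with piσ-∷ B {B'} {rest} B'≢[]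
  ... | ρ , Π , piσ-rest , piσ-σ =
    subst (λ π → Dominates k π _) (sym piσ-σ)
      (dominates-∷ 1≤k B! xu↭B (rotatedBlock-↭ ρ B) (rotatedBlock-RotatedLt B! B≢ρ) B≢y B≢ρ
                   tail-dominates
         (λ eq → differ (trans eq (sym piσ-σ))))
    where
    B! : Unique B
    B! = proj₁ (AllPairs-++⁻ B σ!)

    rest! : Unique (concat (B' ∷ rest))
    rest! = proj₁ (proj₂ (AllPairs-++⁻ B σ!))

    B-avoids : ∀ {z} → z ∈ concat (B' ∷ rest) → All (_≢ z) B
    B-avoids z∈ = All.map (λ b≢rest → All.lookup b≢rest z∈) (proj₂ (proj₂ (AllPairs-++⁻ B σ!)))

    B≢ρ : All (_≢ ρ) B
    B≢ρ = B-avoids (∈-resp-↭ (piσ-↭ (B' ∷ rest)) (subst (ρ ∈_) (sym piσ-rest) (here refl)))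

    B≢y : All (_≢ y) B
    B≢y = B-avoids (∈-resp-↭ (concat-↭ vvs↭) (here refl))

    tail-dominates : y ∷ v ++ concat vs ≢ ρ ∷ Π →
                     Dominates (k + length (x ∷ u)) (ρ ∷ Π) (y ∷ v ++ concat vs)
    tail-dominates ne = subst (λ π → Dominates (k + length (x ∷ u)) π (y ∷ v ++ concat vs)) piσ-rest
      (piσ-dominates (≤-trans 1≤k (m≤m+n k (length (x ∷ u)))) (B' ∷ rest) B'rest≢[] rest! vvs↭
                     (λ eq → ne (trans eq piσ-rest)))

  occurrences : Fin n → List L → ℕ
  occurrences i l = length (filter (λ x → proj₁ x Fin.≟ i) l)

  occurrences-∷ : ∀ i (x : L) l → occurrences i l ≤ occurrences i (x ∷ l)
  occurrences-∷ i x l with proj₁ x Fin.≟ i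
  ... | yes _ = n≤1+n _
  ... | no _ = ≤-refl

  occurrences≤1⇒Unique : ∀ (l : List L) → (∀ i → occurrences i l ≤ 1) → Unique l
  occurrences≤1⇒Unique [] _ = []
  occurrences≤1⇒Unique (x ∷ l) occ≤1 =
    All.tabulate x≢ ∷ occurrences≤1⇒Unique l (λ i → ≤-trans (occurrences-∷ i x l) (occ≤1 i))
    where
    x≢ : ∀ {z} → z ∈ l → x ≢ z
    x≢ z∈l refl = <⇒≱ (s≤s (∈-length (∈-filter⁺ same-letter? z∈l refl)))
                      (subst (_≤ 1) (cong length (filter-accept same-letter? refl)) (occ≤1 (proj₁ x)))
      where
      same-letter? : Decidable (λ y → proj₁ y ≡ proj₁ x)
      same-letter? y = proj₁ y Fin.≟ proj₁ x

  maj-< : ∀ {π w : List L} → π ↭ w → desSum 1 π < desSum 1 w → maj π < maj w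
  maj-< {[]} π↭w d< with ↭-empty-inv (↭-sym π↭w)
  ... | refl = ⊥-elim (<-irrefl refl d<)
  maj-< {π@((_ , j) ∷ _)} {w} π↭w d< =
    subst (λ c → maj π < r * desSum 1 w + c) (sum-↭ (Perm.map⁺ (toℕ ∘ proj₂) π↭w))
          (+-monoˡ-< _ (*-monoʳ-< r ⦃ nonZeroIndex j ⦄ d<))

lemma4p3 : (n r : ℕ) (σ : List (List (Letter n r))) → IsOSP σ →
    (piσ σ ∈CwS σ)
      × ((w : List (Letter n r)) → w ∈CwS σ → ¬ (w ≡ piσ σ) → maj (piσ σ) < maj w)
lemma4p3 n r σ (blocks≢[] , single-copies) = (piBlocks σ , piBlocks-↭ σ , refl) , minimal
  where
  minimal : (w : List (Letter n r)) → w ∈CwS σ → ¬ (w ≡ piσ σ) → maj (piσ σ) < maj w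
  -- for k = 1 the first alternative of Dominates is desSum 1 (piσ σ) < desSum 1 w
  minimal w (ws , ws↭σ , refl) w≢π =
    maj-< (↭-trans (piσ-↭ σ) (↭-sym (concat-↭ ws↭σ)))
          (Sum.[ id , proj₁ ] (piσ-dominates ≤-refl σ blocks≢[] σ! ws↭σ w≢π))
    where
    σ! : Unique (concat σ)
    σ! = occurrences≤1⇒Unique (concat σ) (≤-reflexive ∘ single-copies)
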